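{- Let $G_1$ and $G_2$ be two disjoint finite simple graphs with $|E(G_1)|\ge 1$ and $|E(G_2)|\geq 1$. Then $\mathcal{N}\mathcal{C}(G_1\sqcup G_2)$ is not shellable, and hence not vertex decomposable.
   Context: For a graph $G$, a set $S\subseteq V(G)$ is a cover if $V(G)\setminus S$ contains no two adjacent vertices; the non-cover complex $\mathcal{N}\mathcal{C}(G)$ is the simplicial complex on vertex set $V(G)$ whose simplices are the subsets of $V(G)$ that are not covers of $G$. A simplicial complex $K$ is shellable if its facets can be ordered $F_1,\dots,F_t$ so that for each $k=2,\dots,t$ the complex $\big(\bigcup_{1\le j<k}\Delta^{F_j}\big)\cap\Delta^{F_k}$ is pure of dimension $\dim(\Delta^{F_k})-1$, where $\Delta^F$ is the full simplex on $F$. For a vertex $v$, $\mathrm{lk}(v,K)=\{\tau\in K: v\notin\tau,\ \tau\cup\{v\}\in K\}$ and $\mathrm{del}(v,K)=\{\tau\in K: v\notin \tau\}$; $K$ is vertex decomposable if $K$ is a simplex, or $K$ has a vertex $v$ such that (i) both $\mathrm{lk}(v,K)$ and $\mathrm{del}(v,K)$ are vertex decomposable, and (ii) every facet of $\mathrm{del}(v,K)$ is a facet of $K$. -}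

module Defs where

open import Level using (0ℓ)
open import Data.Nat using (ℕ; _+_; _<_)
open import Data.Integer using (ℤ; +_; _-_)
open import Data.Bool using (Bool; true; false)
open import Data.Fin using (Fin; toℕ; splitAt)
open import Data.Fin.Subset using (Subset; _∈_; _∉_; _⊆_; ∣_∣; ⁅_⁆; _∪_)
open import Data.Sum using (_⊎_; inj₁; inj₂)
open import Data.Product using (_×_; Σ; ∃; ∃-syntax; _,_)
open import Relation.Nullary using (¬_)
open import Relation.Unary using (Pred)
open import Relation.Binary.PropositionalEquality using (_≡_)
open import Function.Definitions using (Injective)

record Graph (n : ℕ) : Set where
  field
    adj     : Fin n → Fin n → Bool
    adj-sym : ∀ u v → adj u v ≡ adj v u
    loopless : ∀ v → adj v v ≡ false
open Graph public

HasEdge : ∀ {n} → Graph n → Set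
HasEdge G = ∃[ u ] ∃[ v ] adj G u v ≡ true

disjAdj : ∀ {n₁ n₂} → Graph n₁ → Graph n₂ → Fin (n₁ + n₂) → Fin (n₁ + n₂) → Bool
disjAdj {n₁} G₁ G₂ u v with splitAt n₁ u | splitAt n₁ v
... | inj₁ a | inj₁ b = adj G₁ a b
... | inj₂ a | inj₂ b = adj G₂ a b
... | inj₁ _ | inj₂ _ = false
... | inj₂ _ | inj₁ _ = false

disjAdj-sym : ∀ {n₁ n₂} (G₁ : Graph n₁) (G₂ : Graph n₂) u v →
              disjAdj G₁ G₂ u v ≡ disjAdj G₁ G₂ v u
disjAdj-sym {n₁} G₁ G₂ u v with splitAt n₁ u | splitAt n₁ v
... | inj₁ a | inj₁ b = adj-sym G₁ a b
... | inj₂ a | inj₂ b = adj-sym G₂ a b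
... | inj₁ _ | inj₂ _ = Relation.Binary.PropositionalEquality.refl
... | inj₂ _ | inj₁ _ = Relation.Binary.PropositionalEquality.refl

disjAdj-loop : ∀ {n₁ n₂} (G₁ : Graph n₁) (G₂ : Graph n₂) v →
               disjAdj G₁ G₂ v v ≡ false
disjAdj-loop {n₁} G₁ G₂ v with splitAt n₁ v
... | inj₁ a = loopless G₁ a
... | inj₂ a = loopless G₂ a

_⊔_ : ∀ {n₁ n₂} → Graph n₁ → Graph n₂ → Graph (n₁ + n₂)
G₁ ⊔ G₂ = record
  { adj = disjAdj G₁ G₂
  ; adj-sym = disjAdj-sym G₁ G₂
  ; loopless = disjAdj-loop G₁ G₂
  }

IsCover : ∀ {n} → Graph n → Subset n → Set
IsCover G S = ∀ u v → u ∉ S → v ∉ S → adj G u v ≡ false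

Complex : ℕ → Set₁
Complex n = Pred (Subset n) 0ℓ

NC : ∀ {n} → Graph n → Complex n
NC G σ = ¬ IsCover G σ

dim : ∀ {n} → Subset n → ℤ
dim σ = + ∣ σ ∣ - + 1

Δ : ∀ {n} → Subset n → Complex n
Δ F σ = σ ⊆ F

IsFacet : ∀ {n} → Complex n → Subset n → Set
IsFacet K σ = K σ × (∀ τ → K τ → σ ⊆ τ → τ ⊆ σ)

PureOfDim : ∀ {n} → ℤ → Complex n → Set
PureOfDim d K = ∀ σ → IsFacet K σ → dim σ ≡ d

Shellable : ∀ {n} → Complex n → Set
Shellable K =
  Σ ℕ λ t → Σ (Fin t → Subset _) λ F →
      (∀ i → IsFacet K (F i))
    × (∀ σ → IsFacet K σ → ∃[ i ] F i ≡ σ)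
    × Injective _≡_ _≡_ F
    × (∀ (k : Fin t) → 0 < toℕ k →
         PureOfDim (dim (F k) - + 1)
           (λ σ → (∃[ j ] (toℕ j < toℕ k × Δ (F j) σ)) × Δ (F k) σ))

IsSimplex : ∀ {n} → Complex n → Set
IsSimplex K = ∃[ F ] (∀ σ → (K σ → Δ F σ) × (Δ F σ → K σ))

lk : ∀ {n} → Fin n → Complex n → Complex n
lk v K τ = v ∉ τ × K (τ ∪ ⁅ v ⁆)

del : ∀ {n} → Fin n → Complex n → Complex n
del v K τ = v ∉ τ × K τ

data VertexDecomposable {n : ℕ} : Complex n → Set₁ where
  simplex : ∀ {K} → IsSimplex K → VertexDecomposable K
  shedding : ∀ {K} (v : Fin n) →
             K ⁅ v ⁆ →
             VertexDecomposable (lk v K) →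
             VertexDecomposable (del v K) →
             (∀ σ → IsFacet (del v K) σ → IsFacet K σ) →
             VertexDecomposable K

-- The facets of NC(G) are exactly the sets V ∖ {u, w} for the edges uw of G. Suppose V splits
-- into two parts with no edge between them, each containing an edge. In a shelling F₀, F₁, …, let
-- F_k = V ∖ {c, d} be the first facet whose edge lies in the other part than the edge of
-- F₀ = V ∖ {a, b}. Every earlier facet misses an edge of the first part, and the only such edge
-- inside {a, b, c, d} is ab; hence V ∖ {a, b, c, d} is a facet of (⋃_{j<k} Δ^{F_j}) ∩ Δ^{F_k}
-- of dimension dim F_k − 2, so this complex is not pure. For vertex decomposability, NC(G) is not
-- a simplex, and no vertex v is a shedding vertex: for an edge cd in the part not containing v,
-- V ∖ {v, c, d} is a facet of del(v, NC(G)) but lies strictly inside the face V ∖ {c, d}.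

module Submission where

open import Defs
open import Data.Bool using (Bool; true; false)
open import Data.Bool.Properties using (¬-not) renaming (_≟_ to _≟ᵇ_)
open import Data.Empty using (⊥-elim)
open import Data.Fin using (Fin; Fin′; zero; suc; toℕ; fromℕ<; inject; splitAt; _↑ˡ_; _↑ʳ_)
open import Data.Fin.Properties
  using (any?; toℕ-injective; toℕ-inject; toℕ-fromℕ<; ¬∀⟶∃¬-smallest; splitAt-↑ˡ; splitAt-↑ʳ)
open import Data.Fin.Subset using (Subset; _∈_; _∉_; _⊆_; ∣_∣; ⁅_⁆; _∩_; ∁; ⊤)
open import Data.Fin.Subset.Properties
  using (_∈?_; ∈⊤; x∈⁅x⁆; x≢y⇒x∉⁅y⁆; x∈p∩q⁺; x∈p∩q⁻; p∩q⊆p; x∈∁p⇒x∉p; x∉p⇒x∈∁p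
        ; ⊆-antisym; p⊂q⇒∣p∣<∣q∣)
open import Data.Integer using (+_; _-_)
open import Data.Integer.Properties using (+-injective)
open import Data.List using (List; []; _∷_; _++_)
open import Data.List.Membership.Propositional using () renaming (_∈_ to _∈ₗ_; _∉_ to _∉ₗ_)
open import Data.List.Membership.Propositional.Properties using (∈-++⁻)
open import Data.List.Relation.Binary.Subset.Propositional using () renaming (_⊆_ to _⊆ₗ_)
open import Data.List.Relation.Binary.Subset.Propositional.Properties using (xs⊆xs++ys; xs⊆ys++xs)
open import Data.List.Relation.Unary.Any using (here; there)
import Data.List.Relation.Unary.Any as Any
open import Data.Nat using (ℕ; zero; suc; _+_; _≤_; _<_; z≤n; s≤s)
open import Data.Nat.Properties using (≤-trans; <-irrefl)
open import Data.Product using (_×_; _,_; proj₁; proj₂; ∃-syntax; ∃₂)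
open import Data.Sum using (_⊎_; inj₁; inj₂)
open import Function using (_∘_)
open import Relation.Nullary using (¬_; yes; no)
open import Relation.Nullary.Decidable using (_×-dec_; ¬?; decidable-stable)
open import Relation.Binary.PropositionalEquality
  using (_≡_; _≢_; refl; sym; trans; cong; subst; module ≡-Reasoning)

module _ {n : ℕ} where

  removing : List (Fin n) → Subset n
  removing []       = ⊤
  removing (x ∷ xs) = removing xs ∩ ∁ ⁅ x ⁆

  ∈-removing⁺ : ∀ {x} xs → x ∉ₗ xs → x ∈ removing xs
  ∈-removing⁺ []       _   = ∈⊤
  ∈-removing⁺ (y ∷ xs) x∉ =
    x∈p∩q⁺ (∈-removing⁺ xs (x∉ ∘ there) , x∉p⇒x∈∁p (x≢y⇒x∉⁅y⁆ (x∉ ∘ here)))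

  ∉-removing⁺ : ∀ {x} xs → x ∈ₗ xs → x ∉ removing xs
  ∉-removing⁺ (y ∷ xs) (here refl)  x∈ = x∈∁p⇒x∉p (proj₂ (x∈p∩q⁻ _ _ x∈)) (x∈⁅x⁆ y)
  ∉-removing⁺ (y ∷ xs) (there x∈xs) x∈ = ∉-removing⁺ xs x∈xs (proj₁ (x∈p∩q⁻ _ _ x∈))

  ∉-removing⁻ : ∀ {x} xs → x ∉ removing xs → x ∈ₗ xs
  ∉-removing⁻ {x} xs x∉ = decidable-stable (Any.any? (Data.Fin._≟_ x) xs) (x∉ ∘ ∈-removing⁺ xs)

  removing-antitone : ∀ {xs ys} → xs ⊆ₗ ys → removing ys ⊆ removing xs
  removing-antitone {xs} {ys} xs⊆ys x∈ = ∈-removing⁺ xs (λ x∈xs → ∉-removing⁺ ys (xs⊆ys x∈xs) x∈)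

  ∣removing-∷∣< : ∀ {x} xs → x ∉ₗ xs → ∣ removing (x ∷ xs) ∣ < ∣ removing xs ∣
  ∣removing-∷∣< {x} xs x∉ = p⊂q⇒∣p∣<∣q∣
    (p∩q⊆p _ _ , x , ∈-removing⁺ xs x∉ , ∉-removing⁺ (x ∷ xs) (here refl))

pair-exhausted : ∀ {A : Set} {u w p q x : A} →
                 p ∈ₗ u ∷ w ∷ [] → q ∈ₗ u ∷ w ∷ [] → p ≢ q → x ∈ₗ u ∷ w ∷ [] → x ≡ p ⊎ x ≡ q
pair-exhausted (here refl)         _                   _   (here refl)         = inj₁ refl
pair-exhausted _                   (here refl)         _   (here refl)         = inj₂ refl
pair-exhausted (there (here refl)) _                   _   (there (here refl)) = inj₁ refl
pair-exhausted _                   (there (here refl)) _   (there (here refl)) = inj₂ refl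
pair-exhausted (here refl)         (here refl)         p≢q _                   = ⊥-elim (p≢q refl)
pair-exhausted (there (here refl)) (there (here refl)) p≢q _                   = ⊥-elim (p≢q refl)

dimσ≡dimτ-1⇒∣τ∣≡1+∣σ∣ : ∀ {n} {σ τ : Subset n} → dim σ ≡ dim τ - + 1 → ∣ τ ∣ ≡ suc ∣ σ ∣
dimσ≡dimτ-1⇒∣τ∣≡1+∣σ∣ eq = go _ _ eq
  where
  go : ∀ m k → + m - + 1 ≡ (+ k - + 1) - + 1 → k ≡ suc m
  go zero    zero          ()
  go zero    (suc zero)    refl = refl
  go (suc m) zero          ()
  go (suc m) (suc (suc k)) eq = cong (λ i → suc (suc i)) (sym (+-injective eq))

below-smallest : ∀ {t} {k : Fin t} (P : Fin t → Set) →
                 ((j : Fin′ k) → P (inject j)) → ∀ j → toℕ j < toℕ k → P j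
below-smallest P all-below j j<k =
  subst P (toℕ-injective (trans (toℕ-inject _) (toℕ-fromℕ< j<k))) (all-below (fromℕ< j<k))

module NonCoverComplex {n : ℕ} (G : Graph n) where

  K : Complex n
  K = NC G

  Edge : Fin n → Fin n → Set
  Edge u w = adj G u w ≡ true

  edge-irrefl : ∀ {u w} → Edge u w → u ≢ w
  edge-irrefl {u} e refl with () ← trans (sym e) (loopless G u)

  uncovered⇒∈NC : ∀ {σ u w} → Edge u w → u ∉ σ → w ∉ σ → K σ
  uncovered⇒∈NC e u∉ w∉ cover with () ← trans (sym e) (cover _ _ u∉ w∉)

  record UncoveredEdge (σ : Subset n) : Set where
    constructor uncovered
    field
      {u w} : Fin n
      edge  : Edge u w
      u∉    : u ∉ σ
      w∉    : w ∉ σ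

  ∈NC⇒uncovered : ∀ {σ} → K σ → UncoveredEdge σ
  ∈NC⇒uncovered {σ} notCover
    with any? (λ u → any? λ w → (adj G u w ≟ᵇ true) ×-dec ¬? (u ∈? σ) ×-dec ¬? (w ∈? σ))
  ... | yes (u , w , e , u∉ , w∉) = uncovered e u∉ w∉
  ... | no none = ⊥-elim (notCover λ u w u∉ w∉ → ¬-not λ e → none (u , w , e , u∉ , w∉))

  removing-edge-∈NC : ∀ {u w} → Edge u w → K (removing (u ∷ w ∷ []))
  removing-edge-∈NC {u} {w} e = uncovered⇒∈NC e
    (∉-removing⁺ (u ∷ w ∷ []) (here refl)) (∉-removing⁺ (u ∷ w ∷ []) (there (here refl)))

  edge-∈-pair⇒∉ : ∀ {τ u w p q x} → Edge p q →
                       p ∈ₗ u ∷ w ∷ [] → q ∈ₗ u ∷ w ∷ [] → p ∉ τ → q ∉ τ →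
                       x ∈ₗ u ∷ w ∷ [] → x ∉ τ
  edge-∈-pair⇒∉ pq p∈ q∈ p∉ q∉ x∈ with pair-exhausted p∈ q∈ (edge-irrefl pq) x∈
  ... | inj₁ refl = p∉
  ... | inj₂ refl = q∉

  removing-edge-isFacet : ∀ {u w} → Edge u w → IsFacet K (removing (u ∷ w ∷ []))
  removing-edge-isFacet {u} {w} e = removing-edge-∈NC e , maximal
    where
    uw = u ∷ w ∷ []
    maximal : ∀ τ → K τ → removing uw ⊆ τ → τ ⊆ removing uw
    maximal τ Kτ uw∁⊆τ x∈τ with ∈NC⇒uncovered Kτ
    ... | uncovered pq p∉ q∉ = ∈-removing⁺ uw λ x∈uw →
      edge-∈-pair⇒∉ pq (∉-removing⁻ uw (p∉ ∘ uw∁⊆τ)) (∉-removing⁻ uw (q∉ ∘ uw∁⊆τ))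
                    p∉ q∉ x∈uw x∈τ

  isFacet⇒≡removing-edge : ∀ {F u w} → IsFacet K F → Edge u w → u ∉ F → w ∉ F →
                           F ≡ removing (u ∷ w ∷ [])
  isFacet⇒≡removing-edge {F} {u} {w} (_ , maximal) e u∉ w∉ =
    ⊆-antisym F⊆removing (maximal _ (removing-edge-∈NC e) F⊆removing)
    where
    F⊆removing : F ⊆ removing (u ∷ w ∷ [])
    F⊆removing x∈F =
      ∈-removing⁺ (u ∷ w ∷ []) λ { (here refl) → u∉ x∈F ; (there (here refl)) → w∉ x∈F }

  module TwoSided (part : Fin n → Bool) (part-edge : ∀ {u w} → Edge u w → part u ≡ part w) where

    part-∈-edge : ∀ {a b x} → Edge a b → x ∈ₗ a ∷ b ∷ [] → part x ≡ part a
    part-∈-edge ab (here refl)         = refl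
    part-∈-edge ab (there (here refl)) = sym (part-edge ab)

    edge-∈-++⁻ : ∀ {p q} xs {ys} → Edge p q → p ∈ₗ xs ++ ys → q ∈ₗ xs ++ ys →
                  (∀ {x y} → x ∈ₗ xs → y ∈ₗ ys → part x ≢ part y) →
                  (p ∈ₗ xs × q ∈ₗ xs) ⊎ (p ∈ₗ ys × q ∈ₗ ys)
    edge-∈-++⁻ xs pq p∈ q∈ apart with ∈-++⁻ xs p∈ | ∈-++⁻ xs q∈
    ... | inj₁ p∈xs | inj₁ q∈xs = inj₁ (p∈xs , q∈xs)
    ... | inj₂ p∈ys | inj₂ q∈ys = inj₂ (p∈ys , q∈ys)
    ... | inj₁ p∈xs | inj₂ q∈ys = ⊥-elim (apart p∈xs q∈ys (part-edge pq))
    ... | inj₂ p∈ys | inj₁ q∈xs = ⊥-elim (apart q∈xs p∈ys (sym (part-edge pq)))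

    ¬isSimplex : ∀ {a b c d} → Edge a b → Edge c d → part a ≢ part c → ¬ IsSimplex K
    ¬isSimplex {a} {b} ab cd a≁c (F , K⇔ΔF) =
      proj₂ (K⇔ΔF ⊤) ⊤⊆F λ u _ u∉ _ → ⊥-elim (u∉ ∈⊤)
      where
      ⊤⊆F : ⊤ ⊆ F
      ⊤⊆F {x} _ with Any.any? (Data.Fin._≟_ x) (a ∷ b ∷ [])
      ... | no x∉ab  = proj₁ (K⇔ΔF _) (removing-edge-∈NC ab) (∈-removing⁺ _ x∉ab)
      ... | yes x∈ab = proj₁ (K⇔ΔF _) (removing-edge-∈NC cd) (∈-removing⁺ _ λ x∈cd →
        a≁c (trans (sym (part-∈-edge ab x∈ab)) (part-∈-edge cd x∈cd)))

    ¬shedding : ∀ {v c d} → Edge c d → part c ≢ part v →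
                ¬ (∀ σ → IsFacet (del v K) σ → IsFacet K σ)
    ¬shedding {v} {c} {d} cd c≁v shed =
      v∉σ (proj₂ (shed σ σ-facet) _ (removing-edge-∈NC cd) σ⊆cd∁ v∈cd∁)
      where
      cd′ = c ∷ d ∷ []
      cdv = cd′ ++ v ∷ []
      σ = removing cdv
      v∉σ : v ∉ σ
      v∉σ = ∉-removing⁺ cdv (there (there (here refl)))
      σ⊆cd∁ : σ ⊆ removing cd′
      σ⊆cd∁ = removing-antitone (xs⊆xs++ys cd′ (v ∷ []))
      v∈cd∁ : v ∈ removing cd′
      v∈cd∁ = ∈-removing⁺ cd′ λ v∈cd → c≁v (sym (part-∈-edge cd v∈cd))
      apart : ∀ {x y} → x ∈ₗ cd′ → y ∈ₗ v ∷ [] → part x ≢ part y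
      apart x∈cd (here refl) x~v = c≁v (trans (sym (part-∈-edge cd x∈cd)) x~v)
      maximal : ∀ τ → del v K τ → σ ⊆ τ → τ ⊆ σ
      maximal τ (v∉τ , Kτ) σ⊆τ {x} x∈τ with ∈NC⇒uncovered Kτ
      ... | uncovered pq p∉ q∉
        with edge-∈-++⁻ cd′ pq (∉-removing⁻ cdv (p∉ ∘ σ⊆τ)) (∉-removing⁻ cdv (q∉ ∘ σ⊆τ)) apart
      ... | inj₂ (here refl , here refl) = ⊥-elim (edge-irrefl pq refl)
      ... | inj₁ (p∈cd , q∈cd) = ∈-removing⁺ cdv x∉
        where
        x∉ : x ∉ₗ cdv
        x∉ x∈ with ∈-++⁻ cd′ x∈
        ... | inj₁ x∈cd        = edge-∈-pair⇒∉ pq p∈cd q∈cd p∉ q∉ x∈cd x∈τ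
        ... | inj₂ (here refl) = v∉τ x∈τ
      σ-facet : IsFacet (del v K) σ
      σ-facet = (v∉σ , uncovered⇒∈NC cd (∉-removing⁺ cdv (here refl))
                                        (∉-removing⁺ cdv (there (here refl))))
              , maximal

    ¬vertexDecomposable : ∀ {a b c d} → Edge a b → Edge c d → part a ≢ part c →
                          ¬ VertexDecomposable K
    ¬vertexDecomposable ab cd a≁c (simplex isSimplex) = ¬isSimplex ab cd a≁c isSimplex
    ¬vertexDecomposable {a} ab cd a≁c (shedding v _ _ _ shed) with part a ≟ᵇ part v
    ... | yes a~v = ¬shedding cd (λ c~v → a≁c (trans a~v (sym c~v))) shed
    ... | no  a≁v = ¬shedding ab a≁v shed

    intersection-not-pure :
      ∀ {a b c d} (E : Complex n) → Edge a b → Edge c d → part a ≢ part c →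
      (∀ {τ} → E τ → ∃₂ λ p q → Edge p q × part p ≡ part a × p ∉ τ × q ∉ τ) →
      E (removing (a ∷ b ∷ c ∷ d ∷ [])) →
      ¬ PureOfDim (dim (removing (c ∷ d ∷ [])) - + 1) (λ τ → E τ × Δ (removing (c ∷ d ∷ [])) τ)
    intersection-not-pure {a} {b} {c} {d} E ab cd a≁c avoids Eσ pure =
      <-irrefl refl (subst (suc (suc ∣ σ ∣) ≤_) one-more two-more)
      where
      ab′ = a ∷ b ∷ []
      cd′ = c ∷ d ∷ []
      abcd = ab′ ++ cd′
      σ = removing abcd
      apart : ∀ {x y} → x ∈ₗ ab′ → y ∈ₗ cd′ → part x ≢ part y
      apart x∈ab y∈cd x~y =
        a≁c (trans (sym (part-∈-edge ab x∈ab)) (trans x~y (part-∈-edge cd y∈cd)))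
      two-more : suc (suc ∣ σ ∣) ≤ ∣ removing cd′ ∣
      two-more = ≤-trans (s≤s (∣removing-∷∣< (b ∷ cd′) a∉bcd)) (∣removing-∷∣< cd′ b∉cd)
        where
        a∉bcd : a ∉ₗ b ∷ cd′
        a∉bcd (here a≡b)   = edge-irrefl ab a≡b
        a∉bcd (there a∈cd) = apart (here refl) a∈cd refl
        b∉cd : b ∉ₗ cd′
        b∉cd b∈cd = apart (there (here refl)) b∈cd refl
      maximal : ∀ τ → E τ × Δ (removing cd′) τ → σ ⊆ τ → τ ⊆ σ
      maximal τ (Eτ , τ⊆cd∁) σ⊆τ {x} x∈τ with avoids Eτ
      ... | p , q , pq , p~a , p∉ , q∉
        with edge-∈-++⁻ ab′ pq (∉-removing⁻ abcd (p∉ ∘ σ⊆τ)) (∉-removing⁻ abcd (q∉ ∘ σ⊆τ)) apart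
      ... | inj₂ (p∈cd , _) = ⊥-elim (apart (here refl) p∈cd (sym p~a))
      ... | inj₁ (p∈ab , q∈ab) = ∈-removing⁺ abcd x∉
        where
        x∉ : x ∉ₗ abcd
        x∉ x∈ with ∈-++⁻ ab′ x∈
        ... | inj₁ x∈ab = edge-∈-pair⇒∉ pq p∈ab q∈ab p∉ q∉ x∈ab x∈τ
        ... | inj₂ x∈cd = ∉-removing⁺ cd′ x∈cd (τ⊆cd∁ x∈τ)
      σ-facet : IsFacet (λ τ → E τ × Δ (removing cd′) τ) σ
      σ-facet = (Eσ , removing-antitone (xs⊆ys++xs cd′ ab′)) , maximal
      one-more : ∣ removing cd′ ∣ ≡ suc ∣ σ ∣
      one-more = dimσ≡dimτ-1⇒∣τ∣≡1+∣σ∣ {σ = σ} {τ = removing cd′} (pure σ σ-facet)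

    sideOf : ∀ {F} → IsFacet K F → Bool
    sideOf facet = part (UncoveredEdge.u (∈NC⇒uncovered (proj₁ facet)))

    sideOf-≡removing : ∀ {F u w} (facet : IsFacet K F) → Edge u w → F ≡ removing (u ∷ w ∷ []) →
                       sideOf facet ≡ part u
    sideOf-≡removing {u = u} {w} facet e refl =
      part-∈-edge e (∉-removing⁻ (u ∷ w ∷ []) (UncoveredEdge.u∉ (∈NC⇒uncovered (proj₁ facet))))

    first-side-switch-not-pure :
      ∀ {t} (F : Fin t → Subset n) (facets : ∀ i → IsFacet K (F i)) {i k : Fin t} →
      toℕ i < toℕ k → sideOf (facets k) ≢ sideOf (facets i) →
      (∀ j → toℕ j < toℕ k → sideOf (facets j) ≡ sideOf (facets i)) →
      ¬ PureOfDim (dim (F k) - + 1) (λ σ → (∃[ j ] (toℕ j < toℕ k × Δ (F j) σ)) × Δ (F k) σ)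
    first-side-switch-not-pure F facets {i} {k} i<k switch before pure =
      intersection-not-pure E ab cd (switch ∘ sym) avoids Eσ
        (subst (λ X → PureOfDim (dim X - + 1) (λ σ → E σ × Δ X σ)) Fk≡cd∁ pure)
      where
      open UncoveredEdge (∈NC⇒uncovered (proj₁ (facets i)))
        renaming (u to a; w to b; edge to ab; u∉ to a∉; w∉ to b∉)
      open UncoveredEdge (∈NC⇒uncovered (proj₁ (facets k)))
        renaming (u to c; w to d; edge to cd; u∉ to c∉; w∉ to d∉)
      E : Complex n
      E σ = ∃[ j ] (toℕ j < toℕ k × Δ (F j) σ)
      Fk≡cd∁ : F k ≡ removing (c ∷ d ∷ [])
      Fk≡cd∁ = isFacet⇒≡removing-edge (facets k) cd c∉ d∉
      avoids : ∀ {τ} → E τ → ∃₂ λ p q → Edge p q × part p ≡ part a × p ∉ τ × q ∉ τ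
      avoids (j , j<k , τ⊆Fj) = let open UncoveredEdge (∈NC⇒uncovered (proj₁ (facets j))) in
        u , w , edge , before j j<k , u∉ ∘ τ⊆Fj , w∉ ∘ τ⊆Fj
      Eσ : E (removing (a ∷ b ∷ c ∷ d ∷ []))
      Eσ = i , i<k , subst (removing (a ∷ b ∷ c ∷ d ∷ []) ⊆_)
                           (sym (isFacet⇒≡removing-edge (facets i) ab a∉ b∉))
                           (removing-antitone (xs⊆xs++ys (a ∷ b ∷ []) (c ∷ d ∷ [])))

    ¬shellable : ∀ {a b c d} → Edge a b → Edge c d → part a ≢ part c → ¬ Shellable K
    ¬shellable ab cd a≁c (zero , F , facets , listed , _)
      with () ← proj₁ (listed _ (removing-edge-isFacet ab))
    ¬shellable {a} {b} {c} {d} ab cd a≁c (suc t , F , facets , listed , _ , shelling) =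
      at-first-switch
        (¬∀⟶∃¬-smallest _ (λ j → side j ≡ side zero) (λ j → side j ≟ᵇ side zero) not-one-sided)
      where
      side : Fin (suc t) → Bool
      side j = sideOf (facets j)
      not-one-sided : ¬ (∀ j → side j ≡ side zero)
      not-one-sided one-sided
        with listed _ (removing-edge-isFacet ab) | listed _ (removing-edge-isFacet cd)
      ... | i , Fi≡ab∁ | j , Fj≡cd∁ = a≁c (begin
        part a     ≡⟨ sideOf-≡removing (facets i) ab Fi≡ab∁ ⟨
        side i     ≡⟨ one-sided i ⟩
        side zero  ≡⟨ one-sided j ⟨
        side j     ≡⟨ sideOf-≡removing (facets j) cd Fj≡cd∁ ⟩
        part c     ∎)
        where open ≡-Reasoning
      at-first-switch :
        ¬ (∃[ k ] (side k ≢ side zero × ((j : Fin′ k) → side (inject j) ≡ side zero)))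
      at-first-switch (zero , switch , _) = switch refl
      at-first-switch (suc k , switch , before) =
        first-side-switch-not-pure F facets (s≤s z≤n) switch
          (below-smallest (λ j → side j ≡ side zero) before) (shelling (suc k) (s≤s z≤n))

module _ {n₁ n₂ : ℕ} where

  inLeft : Fin (n₁ + n₂) → Bool
  inLeft x with splitAt n₁ x
  ... | inj₁ _ = true
  ... | inj₂ _ = false

  inLeft-↑ˡ : ∀ a → inLeft (a ↑ˡ n₂) ≡ true
  inLeft-↑ˡ a rewrite splitAt-↑ˡ n₁ a n₂ = refl

  inLeft-↑ʳ : ∀ c → inLeft (n₁ ↑ʳ c) ≡ false
  inLeft-↑ʳ c rewrite splitAt-↑ʳ n₁ n₂ c = refl

  module _ (G₁ : Graph n₁) (G₂ : Graph n₂) where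

    ⊔-edge-inLeft : ∀ {u w} → adj (G₁ ⊔ G₂) u w ≡ true → inLeft u ≡ inLeft w
    ⊔-edge-inLeft {u} {w} e with splitAt n₁ u | splitAt n₁ w
    ... | inj₁ _ | inj₁ _ = refl
    ... | inj₂ _ | inj₂ _ = refl
    ... | inj₁ _ | inj₂ _ with () ← e
    ... | inj₂ _ | inj₁ _ with () ← e

    ⊔-edge-↑ˡ : ∀ {a b} → adj G₁ a b ≡ true → adj (G₁ ⊔ G₂) (a ↑ˡ n₂) (b ↑ˡ n₂) ≡ true
    ⊔-edge-↑ˡ {a} {b} e rewrite splitAt-↑ˡ n₁ a n₂ | splitAt-↑ˡ n₁ b n₂ = e

    ⊔-edge-↑ʳ : ∀ {c d} → adj G₂ c d ≡ true → adj (G₁ ⊔ G₂) (n₁ ↑ʳ c) (n₁ ↑ʳ d) ≡ true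
    ⊔-edge-↑ʳ {c} {d} e rewrite splitAt-↑ʳ n₁ n₂ c | splitAt-↑ʳ n₁ n₂ d = e

proposition4p4 : (n₁ n₂ : ℕ) (G₁ : Graph n₁) (G₂ : Graph n₂) →
    HasEdge G₁ → HasEdge G₂ →
    ¬ Shellable (NC (G₁ ⊔ G₂)) × ¬ VertexDecomposable (NC (G₁ ⊔ G₂))
proposition4p4 n₁ n₂ G₁ G₂ (a , b , ab) (c , d , cd) =
  ¬shellable ab′ cd′ sides-differ , ¬vertexDecomposable ab′ cd′ sides-differ
  where
  open NonCoverComplex (G₁ ⊔ G₂)
  open TwoSided (inLeft {n₁} {n₂}) (⊔-edge-inLeft G₁ G₂)
  ab′ = ⊔-edge-↑ˡ G₁ G₂ ab
  cd′ = ⊔-edge-↑ʳ G₁ G₂ cd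
  sides-differ : inLeft {n₁} (a ↑ˡ n₂) ≢ inLeft (n₁ ↑ʳ c)
  sides-differ eq with () ← trans (sym (inLeft-↑ˡ a)) (trans eq (inLeft-↑ʳ c))
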